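{- Let $\mathcal{S}$ be a set of $\{0,1\}$-valued sequences. Then $\mathcal{S}$ converges uniformly metastably if and only if there is a countable ordinal $\alpha<\omega_1$ such that $\mathcal{S}$ converges abstractly $\alpha$-uniformly.
   Context: A sequence is $\bar a=(a_n)_{n\in\mathbb{N}}$ with $a_n\in\{0,1\}$. $\mathcal{S}$ converges uniformly metastably if for every $F:\mathbb{N}\to\mathbb{N}$ with $n<F(n)$ and $F(n)\le F(n+1)$ for all $n$, there is $M_F$ such that for every $\bar a\in\mathcal{S}$ there are $m\le M_F$ and $c\in\{0,1\}$ with $a_n=c$ for all $n\in[m,F(m)]$. $T_{\mathcal{S}}$ is the tree of finite strictly increasing sequences $0<r_1<\cdots<r_M$ ($M\ge 0$) such that, setting $r_0=0$, there is some $\bar a\in\mathcal{S}$ such that for every $i<M$ there are $n_0,n_1\in[r_i,r_{i+1}]$ with $a_{n_0}=0$ and $a_{n_1}=1$ (this set is closed under initial segments). Height of a tree $T$ (a set of finite sequences closed under initial segments): if $T$ has no infinite branch, define $\rho_T(s)=\sup\{\rho_T(t)+1: t\in T \text{ an immediate extension of } s\}$ for $s\in T$ and the height of $T$ is $\sup\{\rho_T(s)+1: s\in T\}$ (so the empty tree has height $0$ and the tree consisting only of the empty sequence has height $1$); if $T$ has an infinite branch, its height is regarded as larger than every ordinal. For an ordinal $\alpha<\omega_1$, $\mathcal{S}$ converges abstractly $\alpha$-uniformly if $T_{\mathcal{S}}$ has height strictly less than $\alpha$. -}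

module Defs where

open import Data.Nat using (ℕ; zero; suc; _≤_; _<_)
open import Data.Bool using (Bool; true; false)
open import Data.List using (List; []; _∷_; _++_; [_])
open import Data.Product using (Σ; ∃; ∃-syntax; _×_; _,_)
open import Data.Unit using (⊤)
open import Data.Empty using (⊥)
open import Relation.Binary.PropositionalEquality using (_≡_)

-- {0,1}-valued sequences (0 = false, 1 = true) and sets of them (predicates).
Seq : Set
Seq = ℕ → Bool

SeqSet : Set₁
SeqSet = Seq → Set

UniformlyMetastable : SeqSet → Set
UniformlyMetastable 𝒮 =
  (F : ℕ → ℕ) → (∀ n → n < F n) → (∀ n → F n ≤ F (suc n)) →
  ∃[ M ] ((a : Seq) → 𝒮 a →
    ∃[ m ] (m ≤ M × ∃[ c ] (∀ n → m ≤ n → n ≤ F m → a n ≡ c)))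

Oscillates : Seq → ℕ → ℕ → Set
Oscillates a lo hi =
  ∃[ n₀ ] (lo ≤ n₀ × n₀ ≤ hi × a n₀ ≡ false) ×
  ∃[ n₁ ] (lo ≤ n₁ × n₁ ≤ hi × a n₁ ≡ true)

Good : Seq → ℕ → List ℕ → Set
Good a lo []       = ⊤
Good a lo (r ∷ rs) = lo < r × Oscillates a lo r × Good a r rs

T : SeqSet → List ℕ → Set
T 𝒮 rs = ∃[ a ] (𝒮 a × Good a 0 rs)

-- Countable ordinals: Brouwer ordinals with their standard order.

data Ord : Set where
  oz   : Ord
  os   : Ord → Ord
  olim : (ℕ → Ord) → Ord

mutual
  _≤ₒ_ : Ord → Ord → Set
  oz     ≤ₒ b = ⊤
  os a   ≤ₒ b = a <ₒ b
  olim f ≤ₒ b = ∀ n → f n ≤ₒ b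

  _<ₒ_ : Ord → Ord → Set
  a <ₒ oz     = ⊥
  a <ₒ os b   = a ≤ₒ b
  a <ₒ olim f = ∃[ n ] (a <ₒ f n)

-- A rank function into β is a map ρ on the nodes
-- with ρ(t) < ρ(s) for every immediate extension t = s ++ [n] of s and
-- ρ(s) < β for all s; the height (sup of ρ_T(s)+1) is ≤ β exactly when
-- such a ρ exists (and no such ρ exists if T has an infinite branch).

RankedBelow : (List ℕ → Set) → Ord → Set
RankedBelow Tr β =
  Σ ((s : List ℕ) → Tr s → Ord) λ ρ →
    (∀ s (p : Tr s) n (q : Tr (s ++ [ n ])) → ρ (s ++ [ n ]) q <ₒ ρ s p) ×
    (∀ s (p : Tr s) → ρ s p <ₒ β)

HeightLessThan : (List ℕ → Set) → Ord → Set
HeightLessThan Tr α = ∃[ β ] (β <ₒ α × RankedBelow Tr β)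

AbstractlyUniform : Ord → SeqSet → Set
AbstractlyUniform α 𝒮 = HeightLessThan (T 𝒮) α

-- Both conditions say that T_𝒮 has no infinite branch.  An infinite branch
-- 0 = r₀ < r₁ < r₂ < … defeats metastability for F(m) = r_{m+1}: for every
-- bound M the sequence chosen at depth M + 1 oscillates on [r_m, r_{m+1}],
-- which lies inside [m, F(m)] since m ≤ r_m.  Conversely, if metastability
-- fails for F, the iterates 0, F(0), F(F(0)), … form an infinite branch: the
-- counterexample for the bound M = F^k(0) oscillates on each interval
-- [F^i(0), F^{i+1}(0)] with i < k.  Finally, a tree on ℕ admits a rank into
-- the Brouwer ordinals iff it has no infinite branch: ranks strictly decrease
-- along a branch, and classically a tree without infinite branch is
-- well-founded, so ρ(s) = sup { ρ(t) + 1 : t a child of s } is defined.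
module Submission where

open import Defs
open import Level using (0ℓ)
open import Data.Product using (∃-syntax)
open import Function.Bundles using (_⇔_)
open import Axiom.ExcludedMiddle using (ExcludedMiddle)

open import Axiom.DoubleNegationElimination using (DoubleNegationElimination; em⇒dne)
open import Data.Bool using (false; true; not)
open import Data.Bool.Properties using (¬-not)
open import Data.List using (List; []; _∷_; _++_; _∷ʳ_; applyUpTo)
open import Data.List.Properties using (applyUpTo-∷ʳ)
open import Data.List.Reverse using (Reverse; []; _∶_∶ʳ_; reverseView)
open import Data.Nat using (ℕ; zero; suc; _≤_; _<_; z≤n; s≤s)
open import Data.Nat.Properties using (≤-refl; ≤-trans; ≤-<-trans; <⇒≤; n<1+n; m≤n⇒m<n∨m≡n)
open import Data.Product using (Σ; ∃; _×_; _,_; proj₁; proj₂)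
open import Data.Sum using (inj₁; inj₂)
open import Data.Unit using (tt)
open import Function.Base using (_∘_)
open import Function.Bundles using (Equivalence; mk⇔)
open import Relation.Nullary using (¬_; Dec; yes; no)
open import Relation.Binary.PropositionalEquality using (_≡_; refl; sym; trans; cong; subst; module ≡-Reasoning)
open ≡-Reasoning

mutual
  ≤ₒ-<ₒ-trans : ∀ x y z → x ≤ₒ y → y <ₒ z → x <ₒ z
  ≤ₒ-<ₒ-trans x y oz       _   ()
  ≤ₒ-<ₒ-trans x y (os z)   x≤y y≤z        = ≤ₒ-trans x y z x≤y y≤z
  ≤ₒ-<ₒ-trans x y (olim f) x≤y (n , y<fn) = n , ≤ₒ-<ₒ-trans x y (f n) x≤y y<fn

  <ₒ-≤ₒ-trans : ∀ x y z → x <ₒ y → y ≤ₒ z → x <ₒ z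
  <ₒ-≤ₒ-trans x oz       z ()         _
  <ₒ-≤ₒ-trans x (os y)   z x≤y        y<z = ≤ₒ-<ₒ-trans x y z x≤y y<z
  <ₒ-≤ₒ-trans x (olim f) z (n , x<fn) f≤z = <ₒ-≤ₒ-trans x (f n) z x<fn (f≤z n)

  ≤ₒ-trans : ∀ x y z → x ≤ₒ y → y ≤ₒ z → x ≤ₒ z
  ≤ₒ-trans oz       y z _   _     = tt
  ≤ₒ-trans (os x)   y z x<y y≤z   = <ₒ-≤ₒ-trans x y z x<y y≤z
  ≤ₒ-trans (olim f) y z f≤y y≤z n = ≤ₒ-trans (f n) y z (f≤y n) y≤z

≤ₒ-olim : ∀ x (f : ℕ → Ord) n → x ≤ₒ f n → x ≤ₒ olim f
≤ₒ-olim oz       f n _     = tt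
≤ₒ-olim (os x)   f n x<fn  = n , x<fn
≤ₒ-olim (olim g) f n g≤fn m = ≤ₒ-olim (g m) f n (g≤fn m)

≤ₒ-refl : ∀ x → x ≤ₒ x
≤ₒ-refl oz       = tt
≤ₒ-refl (os x)   = ≤ₒ-refl x
≤ₒ-refl (olim f) = λ n → ≤ₒ-olim (f n) f n (≤ₒ-refl (f n))

mutual
  ≤ₒ-os : ∀ x y → x ≤ₒ y → x ≤ₒ os y
  ≤ₒ-os oz       y _     = tt
  ≤ₒ-os (os x)   y x<y   = <ₒ⇒≤ₒ x y x<y
  ≤ₒ-os (olim f) y f≤y n = ≤ₒ-os (f n) y (f≤y n)

  <ₒ⇒≤ₒ : ∀ x y → x <ₒ y → x ≤ₒ y
  <ₒ⇒≤ₒ x y x<y = ≤ₒ-trans x (os x) y (≤ₒ-os x x (≤ₒ-refl x)) x<y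

<ₒ-noInfiniteDescent : ∀ β (g : ℕ → Ord) → (∀ k → g (suc k) <ₒ g k) → ¬ (g 0 <ₒ β)
<ₒ-noInfiniteDescent oz       g descent ()
<ₒ-noInfiniteDescent (os β)   g descent g₀≤β =
  <ₒ-noInfiniteDescent β (g ∘ suc) (descent ∘ suc)
    (<ₒ-≤ₒ-trans (g 1) (g 0) β (descent 0) g₀≤β)
<ₒ-noInfiniteDescent (olim f) g descent (n , g₀<fn) = <ₒ-noInfiniteDescent (f n) g descent g₀<fn

PrefixClosed : (List ℕ → Set) → Set
PrefixClosed Tr = ∀ s n → Tr (s ∷ʳ n) → Tr s

InfiniteBranch : (List ℕ → Set) → Set
InfiniteBranch Tr = Σ (ℕ → ℕ) λ r → ∀ k → Tr (applyUpTo r k)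

rankedBelow⇒¬infiniteBranch : ∀ {Tr β} → RankedBelow Tr β → ¬ InfiniteBranch Tr
rankedBelow⇒¬infiniteBranch {Tr} {β} (ρ , descent , bounded) (r , onBranch) =
  <ₒ-noInfiniteDescent β (λ k → ρ (applyUpTo r k) (onBranch k))
    (λ k → descent-≡ (onBranch k) (onBranch (suc k)) (applyUpTo-∷ʳ r k))
    (bounded [] (onBranch 0))
  where
  descent-≡ : ∀ {s n t} (p : Tr s) (q : Tr t) → s ∷ʳ n ≡ t → ρ t q <ₒ ρ s p
  descent-≡ {s} {n} p q refl = descent s p n q

heightLessThan⇒¬infiniteBranch : ∀ {Tr α} → HeightLessThan Tr α → ¬ InfiniteBranch Tr
heightLessThan⇒¬infiniteBranch (β , _ , ranked) = rankedBelow⇒¬infiniteBranch {β = β} ranked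

module _ (Tr : List ℕ → Set) where

  record Accessible (s : List ℕ) : Set where
    inductive
    pattern
    constructor acc
    field children : ∀ n → Tr (s ∷ʳ n) → Accessible (s ∷ʳ n)

  open Accessible

  module _ (dne : DoubleNegationElimination 0ℓ) where

    inaccessibleChild : ∀ {s} → ¬ Accessible s → ∃[ n ] (Tr (s ∷ʳ n) × ¬ Accessible (s ∷ʳ n))
    inaccessibleChild ¬acc =
      dne λ none → ¬acc (acc λ n q → dne λ ¬accₙ → none (n , q , ¬accₙ))

    inaccessible⇒infiniteBranch : PrefixClosed Tr → ¬ Accessible [] → InfiniteBranch Tr
    inaccessible⇒infiniteBranch closed ¬acc = r , onBranch
      where
      descend : ℕ → Σ (List ℕ) (¬_ ∘ Accessible)
      descend zero    = [] , ¬acc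
      descend (suc k) =
        let (s , ¬accₛ) = descend k
            (n , _ , ¬accₙ) = inaccessibleChild ¬accₛ
        in s ∷ʳ n , ¬accₙ

      r : ℕ → ℕ
      r k = proj₁ (inaccessibleChild (proj₂ (descend k)))

      child∈Tr : ∀ k → Tr (proj₁ (descend k) ∷ʳ r k)
      child∈Tr k = proj₁ (proj₂ (inaccessibleChild (proj₂ (descend k))))

      descend≡applyUpTo : ∀ k → proj₁ (descend k) ≡ applyUpTo r k
      descend≡applyUpTo zero    = refl
      descend≡applyUpTo (suc k) = trans (cong (_∷ʳ r k) (descend≡applyUpTo k)) (applyUpTo-∷ʳ r k)

      onBranch : ∀ k → Tr (applyUpTo r k)
      onBranch zero    = closed [] (r 0) (child∈Tr 0)
      onBranch (suc k) = subst Tr (descend≡applyUpTo (suc k)) (child∈Tr k)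

    ¬infiniteBranch⇒accessible : PrefixClosed Tr → ¬ InfiniteBranch Tr → Accessible []
    ¬infiniteBranch⇒accessible closed ¬branch =
      dne λ ¬acc → ¬branch (inaccessible⇒infiniteBranch closed ¬acc)

  module _ (em : ExcludedMiddle 0ℓ) where

    osIf : {P : Set} → Dec P → (P → Ord) → Ord
    osIf (yes p) k = os (k p)
    osIf (no _)  k = oz

    osIf-mono : ∀ {P : Set} (d : Dec P) {k₁ k₂ : P → Ord} →
                (∀ p → k₁ p ≤ₒ k₂ p) → osIf d k₁ ≤ₒ osIf d k₂
    osIf-mono (yes p) k₁≤k₂ = k₁≤k₂ p
    osIf-mono (no _)  k₁≤k₂ = tt

    <ₒ-osIf : ∀ {P : Set} (d : Dec P) {k : P → Ord} {x} → P → (∀ p → x ≤ₒ k p) → x <ₒ osIf d k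
    <ₒ-osIf (yes p) _ x≤k = x≤k p
    <ₒ-osIf (no ¬p) p _   with () ← ¬p p

    mutual
      rank : ∀ {s} → Accessible s → Ord
      rank a = olim (childRank a)

      childRank : ∀ {s} → Accessible s → ℕ → Ord
      childRank {s} (acc ch) n = osIf (em {Tr (s ∷ʳ n)}) (λ q → rank (ch n q))

    -- Accessibility proofs are not unique, but their ranks agree.
    mutual
      rank-irrelevant : ∀ {s} (a b : Accessible s) → rank a ≤ₒ rank b
      rank-irrelevant a b n = ≤ₒ-olim (childRank a n) (childRank b) n (childRank-irrelevant a b n)

      childRank-irrelevant : ∀ {s} (a b : Accessible s) n → childRank a n ≤ₒ childRank b n
      childRank-irrelevant (acc ch₁) (acc ch₂) n =
        osIf-mono em λ q → rank-irrelevant (ch₁ n q) (ch₂ n q)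

    rank-child : ∀ {s n} (a : Accessible s) → Tr (s ∷ʳ n) → (b : Accessible (s ∷ʳ n)) →
                 rank b <ₒ rank a
    rank-child {n = n} (acc ch) q b = n , <ₒ-osIf em q λ q′ → rank-irrelevant b (ch n q′)

    module _ (closed : PrefixClosed Tr) (root : Accessible []) where

      accessible : ∀ {s} → Reverse s → Tr s → Accessible s
      accessible []             _ = root
      accessible (s ∶ v ∶ʳ n) q = children (accessible v (closed s n q)) n q

      ρ : (s : List ℕ) → Tr s → Ord
      ρ s p = rank (accessible (reverseView s) p)

      ρ-descent : ∀ s (p : Tr s) n (q : Tr (s ∷ʳ n)) → ρ (s ∷ʳ n) q <ₒ ρ s p
      ρ-descent s p n q =
        rank-child (accessible (reverseView s) p) q (accessible (reverseView (s ∷ʳ n)) q)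

      ρ≤rank-root : ∀ {s} → Reverse s → (p : Tr s) → ρ s p ≤ₒ rank root
      ρ≤rank-root []             p = rank-irrelevant (accessible (reverseView []) p) root
      ρ≤rank-root (s ∶ v ∶ʳ n) q =
        ≤ₒ-trans (ρ (s ∷ʳ n) q) (ρ s p) (rank root)
          (<ₒ⇒≤ₒ (ρ (s ∷ʳ n) q) (ρ s p) (ρ-descent s p n q)) (ρ≤rank-root v p)
        where p = closed s n q

      rankedBelow : RankedBelow Tr (os (rank root))
      rankedBelow = ρ , ρ-descent , λ s → ρ≤rank-root (reverseView s)

    ¬infiniteBranch⇒heightLessThan : PrefixClosed Tr → ¬ InfiniteBranch Tr → ∃[ α ] HeightLessThan Tr α
    ¬infiniteBranch⇒heightLessThan closed ¬branch =
      let root = ¬infiniteBranch⇒accessible (em⇒dne em) closed ¬branch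
          R = rank root
      in os (os R) , os R , ≤ₒ-refl R , rankedBelow closed root

Step : Seq → ℕ → ℕ → Set
Step a lo hi = lo < hi × Oscillates a lo hi

ConstantOn : Seq → ℕ → ℕ → Set
ConstantOn a lo hi = ∃[ c ] (∀ n → lo ≤ n → n ≤ hi → a n ≡ c)

MetastableWithin : (ℕ → ℕ) → ℕ → Seq → Set
MetastableWithin F M a = ∃[ m ] (m ≤ M × ConstantOn a m (F m))

oscillates⇒¬constantOn : ∀ {a lo lo′ hi} → Oscillates a lo hi → lo′ ≤ lo → ¬ ConstantOn a lo′ hi
oscillates⇒¬constantOn {a} (n₀ , (lo≤n₀ , n₀≤hi , a₀) , n₁ , lo≤n₁ , n₁≤hi , a₁) lo′≤lo (c , constant)
  with () ← begin
    false ≡⟨ sym a₀ ⟩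
    a n₀  ≡⟨ constant n₀ (≤-trans lo′≤lo lo≤n₀) n₀≤hi ⟩
    c     ≡⟨ sym (constant n₁ (≤-trans lo′≤lo lo≤n₁) n₁≤hi) ⟩
    a n₁  ≡⟨ a₁ ⟩
    true  ∎

¬constantOn⇒oscillates : DoubleNegationElimination 0ℓ →
                         ∀ {a lo hi} → ¬ ConstantOn a lo hi → Oscillates a lo hi
¬constantOn⇒oscillates dne {a} {lo} {hi} ¬const =
  let (n₀ , inRange₀) = takes false in n₀ , inRange₀ , takes true
  where
  takes : ∀ b → ∃[ n ] (lo ≤ n × n ≤ hi × a n ≡ b)
  takes b = dne λ ¬takes →
    ¬const (not b , λ n lo≤n n≤hi → ¬-not λ aₙ≡b → ¬takes (n , lo≤n , n≤hi , aₙ≡b))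

good⇒step : ∀ {a} (u : ℕ → ℕ) {k i} →
            Good a (u 0) (applyUpTo (u ∘ suc) k) → i < k → Step a (u i) (u (suc i))
good⇒step u {suc k} {zero}  (u₀<u₁ , osc , _) _         = u₀<u₁ , osc
good⇒step u {suc k} {suc i} (_ , _ , good)     (s≤s i<k) = good⇒step (u ∘ suc) good i<k

step⇒good : ∀ {a} (u : ℕ → ℕ) k →
            (∀ i → i < k → Step a (u i) (u (suc i))) → Good a (u 0) (applyUpTo (u ∘ suc) k)
step⇒good u zero    _     = tt
step⇒good u (suc k) steps =
  let (u₀<u₁ , osc) = steps 0 (s≤s z≤n)
  in u₀<u₁ , osc , step⇒good (u ∘ suc) k λ i i<k → steps (suc i) (s≤s i<k)

good-++⁻ : ∀ {a lo} s {t} → Good a lo (s ++ t) → Good a lo s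
good-++⁻ []      _                  = tt
good-++⁻ (r ∷ s) (lo<r , osc , good) = lo<r , osc , good-++⁻ s good

module _ (𝒮 : SeqSet) where

  T-prefixClosed : PrefixClosed (T 𝒮)
  T-prefixClosed s n (a , a∈𝒮 , good) = a , a∈𝒮 , good-++⁻ s good

  metastable⇒¬infiniteBranch : UniformlyMetastable 𝒮 → ¬ InfiniteBranch (T 𝒮)
  metastable⇒¬infiniteBranch metastable (r , onBranch) =
    let (M , within) = metastable r (λ n → i≤vertex (suc n)) (λ n → <⇒≤ (vertex-< (suc n)))
        (a , a∈𝒮 , good) = onBranch (suc M)
        (m , m≤M , constant) = within a a∈𝒮
    in oscillates⇒¬constantOn (proj₂ (good⇒step vertex good (s≤s m≤M))) (i≤vertex m) constant
    where
    vertex : ℕ → ℕ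
    vertex zero    = 0
    vertex (suc i) = r i

    vertex-< : ∀ i → vertex i < vertex (suc i)
    vertex-< i = proj₁ (good⇒step vertex (proj₂ (proj₂ (onBranch (suc i)))) (n<1+n i))

    i≤vertex : ∀ i → i ≤ vertex i
    i≤vertex zero    = z≤n
    i≤vertex (suc i) = ≤-<-trans (i≤vertex i) (vertex-< i)

  ¬infiniteBranch⇒metastable : DoubleNegationElimination 0ℓ →
                               ¬ InfiniteBranch (T 𝒮) → UniformlyMetastable 𝒮
  ¬infiniteBranch⇒metastable dne ¬branch F n<Fn _ =
    dne λ ¬bounded → ¬branch (orbit ∘ suc , onBranch ¬bounded)
    where
    orbit : ℕ → ℕ
    orbit zero    = 0
    orbit (suc k) = F (orbit k)

    orbit-mono : ∀ {i k} → i ≤ k → orbit i ≤ orbit k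
    orbit-mono {k = zero}  z≤n = ≤-refl
    orbit-mono {k = suc k} i≤1+k with m≤n⇒m<n∨m≡n i≤1+k
    ... | inj₁ (s≤s i≤k) = ≤-trans (orbit-mono i≤k) (<⇒≤ (n<Fn (orbit k)))
    ... | inj₂ refl      = ≤-refl

    Bound : ℕ → Set
    Bound M = ∀ a → 𝒮 a → MetastableWithin F M a

    counterexample : ¬ ∃ Bound → ∀ M → ∃[ a ] (𝒮 a × ¬ MetastableWithin F M a)
    counterexample ¬bounded M =
      dne λ none → ¬bounded (M , λ a a∈𝒮 → dne λ ¬within → none (a , a∈𝒮 , ¬within))

    onBranch : ¬ ∃ Bound → ∀ k → T 𝒮 (applyUpTo (orbit ∘ suc) k)
    onBranch ¬bounded k =
      let (a , a∈𝒮 , ¬within) = counterexample ¬bounded (orbit k)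
      in a , a∈𝒮 , step⇒good orbit k λ i i<k →
           n<Fn (orbit i) ,
           ¬constantOn⇒oscillates dne λ constant → ¬within (orbit i , orbit-mono (<⇒≤ i<k) , constant)

  metastable⇔¬infiniteBranch : ExcludedMiddle 0ℓ → UniformlyMetastable 𝒮 ⇔ (¬ InfiniteBranch (T 𝒮))
  metastable⇔¬infiniteBranch em =
    mk⇔ metastable⇒¬infiniteBranch (¬infiniteBranch⇒metastable (em⇒dne em))

mainTheorem1 : ExcludedMiddle 0ℓ → (𝒮 : SeqSet) →
    UniformlyMetastable 𝒮 ⇔ (∃[ α ] AbstractlyUniform α 𝒮)
mainTheorem1 em 𝒮 =
  mk⇔ (λ metastable → ¬infiniteBranch⇒heightLessThan (T 𝒮) em (T-prefixClosed 𝒮) (to metastable))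
      (λ (α , height) → from (heightLessThan⇒¬infiniteBranch {α = α} height))
  where open Equivalence (metastable⇔¬infiniteBranch 𝒮 em)
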